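{- (Truth Lemma) In the canonical model, for every formula $\phi\in\mathbf{Fm}$, $\mathrm{val}(\phi)(f)=f(\phi)$ for every $f\in\mathsf{F}_{\mathbf{A}}(\mathbf{Fm})$ and $\mathrm{descr}(\phi)(i)=i(\phi)$ for every $i\in\mathsf{I}_{\mathbf{A}}(\mathbf{Fm})$.
   Context: $\mathbf{A}=(D,1,0,\vee,\wedge,\otimes,\to)$ is a fixed complete, frame-distributive and dually frame-distributive, commutative and associative residuated lattice with $1\to\alpha=\alpha$. $\mathbf{Fm}$ is the Lindenbaum–Tarski algebra of formulas of the language $\varphi ::= \bot \mid \top \mid p \mid \varphi\wedge\varphi \mid \varphi\vee\varphi \mid \Box\varphi \mid \Diamond\varphi$ modulo the basic normal non-distributive modal logic $\mathbf{L}$ (formulas identified with their classes). Proper $\mathbf{A}$-filters: $f:\mathbf{Fm}\to\mathbf{A}$ with $f(\top)=1$, $f(\bot)=0$, $f(a\wedge b)=f(a)\wedge f(b)$; proper $\mathbf{A}$-ideals: $i:\mathbf{Fm}\to\mathbf{A}$ with $i(\bot)=1$, $i(\top)=0$, $i(a\vee b)=i(a)\wedge i(b)$; sets $\mathsf{F}_{\mathbf{A}}(\mathbf{Fm})$, $\mathsf{I}_{\mathbf{A}}(\mathbf{Fm})$. Canonical frame: $I(f,i)=\bigvee_{\phi}(f(\phi)\otimes i(\phi))$, $R_\Diamond(i,f)=\bigvee_{\phi}(f(\phi)\otimes i(\Diamond\phi))$, $R_\Box(f,i)=\bigvee_\phi(f(\Box\phi)\otimes i(\phi))$; $g^\uparrow(i)=\bigwedge_f(g(f)\to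 I(f,i))$, $u^\downarrow(f)=\bigwedge_i(u(i)\to I(f,i))$. Canonical valuation: $\mathrm{val}(p)(f)=f(p)$, $\mathrm{descr}(p)(i)=i(p)$, extended by: $\mathrm{val}(\top)\equiv1$, $\mathrm{descr}(\top)=\mathrm{val}(\top)^\uparrow$; $\mathrm{descr}(\bot)\equiv1$, $\mathrm{val}(\bot)=\mathrm{descr}(\bot)^\downarrow$; $\mathrm{val}(\phi\wedge\psi)=\mathrm{val}(\phi)\wedge\mathrm{val}(\psi)$, $\mathrm{descr}(\phi\wedge\psi)=\mathrm{val}(\phi\wedge\psi)^\uparrow$; $\mathrm{descr}(\phi\vee\psi)=\mathrm{descr}(\phi)\wedge\mathrm{descr}(\psi)$, $\mathrm{val}(\phi\vee\psi)=\mathrm{descr}(\phi\vee\psi)^\downarrow$; $\mathrm{val}(\Box\phi)(f)=\bigwedge_i(\mathrm{descr}(\phi)(i)\to R_\Box(f,i))$, $\mathrm{descr}(\Box\phi)=\mathrm{val}(\Box\phi)^\uparrow$; $\mathrm{descr}(\Diamond\phi)(i)=\bigwedge_f(\mathrm{val}(\phi)(f)\to R_\Diamond(i,f))$, $\mathrm{val}(\Diamond\phi)=\mathrm{descr}(\Diamond\phi)^\downarrow$. -}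

module Defs where

open import Level using (0ℓ)
open import Data.Product using (_×_; _,_)
open import Relation.Binary.PropositionalEquality using (_≡_)
open import Relation.Binary.Structures using (IsPartialOrder)

-- Complete, frame-distributive and dually frame-distributive,
-- commutative and associative residuated lattice A = (D,1,0,∨,∧,⊗,→)
-- with 1 → α = α.  1 is the top, 0 the bottom (⊗ is not assumed unital).

record CARLattice : Set₁ where
  infixr 6 _∨_
  infixr 7 _∧_
  infixr 8 _⊗_
  infixr 5 _⇒_
  infix 4 _≤_
  field
    D   : Set
    _≤_ : D → D → Set
    isPartialOrder : IsPartialOrder _≡_ _≤_
    𝟏 𝟎 : D
    _∨_ _∧_ _⊗_ _⇒_ : D → D → D
    ⋁ ⋀ : {I : Set} → (I → D) → D
    𝟎-least : ∀ x → 𝟎 ≤ x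
    𝟏-greatest : ∀ x → x ≤ 𝟏
    ∧-lb₁ : ∀ x y → x ∧ y ≤ x
    ∧-lb₂ : ∀ x y → x ∧ y ≤ y
    ∧-glb : ∀ {x y z} → z ≤ x → z ≤ y → z ≤ x ∧ y
    ∨-ub₁ : ∀ x y → x ≤ x ∨ y
    ∨-ub₂ : ∀ x y → y ≤ x ∨ y
    ∨-lub : ∀ {x y z} → x ≤ z → y ≤ z → x ∨ y ≤ z
    ⋁-ub  : ∀ {I : Set} (g : I → D) (j : I) → g j ≤ ⋁ g
    ⋁-lub : ∀ {I : Set} (g : I → D) (z : D) → (∀ j → g j ≤ z) → ⋁ g ≤ z
    ⋀-lb  : ∀ {I : Set} (g : I → D) (j : I) → ⋀ g ≤ g j
    ⋀-glb : ∀ {I : Set} (g : I → D) (z : D) → (∀ j → z ≤ g j) → z ≤ ⋀ g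
    frame-distrib : ∀ {I : Set} (x : D) (g : I → D) → x ∧ ⋁ g ≡ ⋁ (λ j → x ∧ g j)
    dual-frame-distrib : ∀ {I : Set} (x : D) (g : I → D) → x ∨ ⋀ g ≡ ⋀ (λ j → x ∨ g j)
    ⊗-comm  : ∀ x y → x ⊗ y ≡ y ⊗ x
    ⊗-assoc : ∀ x y z → (x ⊗ y) ⊗ z ≡ x ⊗ (y ⊗ z)
    residuation₁ : ∀ {x y z} → x ⊗ y ≤ z → x ≤ y ⇒ z
    residuation₂ : ∀ {x y z} → x ≤ y ⇒ z → x ⊗ y ≤ z
    𝟏⇒ : ∀ x → 𝟏 ⇒ x ≡ x

data Fm (Atom : Set) : Set where
  ⊥' ⊤' : Fm Atom
  var  : Atom → Fm Atom
  _∧'_ _∨'_ : Fm Atom → Fm Atom → Fm Atom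
  □ ◇ : Fm Atom → Fm Atom

-- The basic normal non-distributive modal logic L (as a consequence
-- relation on sequents; axioms are schematic, hence closed under
-- uniform substitution).

module _ {Atom : Set} where

  infix 3 _⊢_
  data _⊢_ : Fm Atom → Fm Atom → Set where
    ax     : ∀ {φ} → φ ⊢ φ
    ⊥-ax   : ∀ {φ} → ⊥' ⊢ φ
    ⊤-ax   : ∀ {φ} → φ ⊢ ⊤'
    ∨-in₁  : ∀ {φ ψ} → φ ⊢ φ ∨' ψ
    ∨-in₂  : ∀ {φ ψ} → ψ ⊢ φ ∨' ψ
    ∧-out₁ : ∀ {φ ψ} → φ ∧' ψ ⊢ φ
    ∧-out₂ : ∀ {φ ψ} → φ ∧' ψ ⊢ ψ
    □⊤     : ⊤' ⊢ □ ⊤'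
    □∧     : ∀ {φ ψ} → □ φ ∧' □ ψ ⊢ □ (φ ∧' ψ)
    ◇⊥     : ◇ ⊥' ⊢ ⊥'
    ◇∨     : ∀ {φ ψ} → ◇ (φ ∨' ψ) ⊢ ◇ φ ∨' ◇ ψ
    cut    : ∀ {φ χ ψ} → φ ⊢ χ → χ ⊢ ψ → φ ⊢ ψ
    ∨-el   : ∀ {φ ψ χ} → φ ⊢ χ → ψ ⊢ χ → φ ∨' ψ ⊢ χ
    ∧-in   : ∀ {φ ψ χ} → χ ⊢ φ → χ ⊢ ψ → χ ⊢ φ ∧' ψ
    □-mono : ∀ {φ ψ} → φ ⊢ ψ → □ φ ⊢ □ ψ
    ◇-mono : ∀ {φ ψ} → φ ⊢ ψ → ◇ φ ⊢ ◇ ψ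

  -- provable equivalence: the kernel of the quotient Fm → Lindenbaum–Tarski algebra
  _⊣⊢_ : Fm Atom → Fm Atom → Set
  φ ⊣⊢ ψ = (φ ⊢ ψ) × (ψ ⊢ φ)

-- Proper A-filters and A-ideals of the Lindenbaum–Tarski algebra,
-- represented as maps on formulas that are invariant under ⊣⊢
-- (i.e. maps on equivalence classes).

module Canonical (Atom : Set) (A : CARLattice) where
  open CARLattice A

  record Filter : Set where
    field
      fn    : Fm Atom → D
      resp  : ∀ {φ ψ} → φ ⊣⊢ ψ → fn φ ≡ fn ψ
      f-top : fn ⊤' ≡ 𝟏
      f-bot : fn ⊥' ≡ 𝟎
      f-meet : ∀ φ ψ → fn (φ ∧' ψ) ≡ fn φ ∧ fn ψ
  open Filter public

  record Ideal : Set where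
    field
      ifn   : Fm Atom → D
      iresp : ∀ {φ ψ} → φ ⊣⊢ ψ → ifn φ ≡ ifn ψ
      i-bot : ifn ⊥' ≡ 𝟏
      i-top : ifn ⊤' ≡ 𝟎
      i-join : ∀ φ ψ → ifn (φ ∨' ψ) ≡ ifn φ ∧ ifn ψ
  open Ideal public

  I : Filter → Ideal → D
  I f i = ⋁ (λ (φ : Fm Atom) → fn f φ ⊗ ifn i φ)

  R◇ : Ideal → Filter → D
  R◇ i f = ⋁ (λ (φ : Fm Atom) → fn f φ ⊗ ifn i (◇ φ))

  R□ : Filter → Ideal → D
  R□ f i = ⋁ (λ (φ : Fm Atom) → fn f (□ φ) ⊗ ifn i φ)

  _↑ : (Filter → D) → (Ideal → D)
  (g ↑) i = ⋀ (λ (f : Filter) → g f ⇒ I f i)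

  _↓ : (Ideal → D) → (Filter → D)
  (u ↓) f = ⋀ (λ (i : Ideal) → u i ⇒ I f i)

  -- canonical valuation (val, descr), by mutual recursion on formulas
  -- (the clauses val(X)=descr(X)↓ / descr(X)=val(X)↑ are unfolded inline)
  mutual
    val : Fm Atom → Filter → D
    val ⊥' = (λ _ → 𝟏) ↓
    val ⊤' = λ _ → 𝟏
    val (var p) = λ f → fn f (var p)
    val (φ ∧' ψ) = λ f → val φ f ∧ val ψ f
    val (φ ∨' ψ) = (λ i → descr φ i ∧ descr ψ i) ↓
    val (□ φ) = λ f → ⋀ (λ (i : Ideal) → descr φ i ⇒ R□ f i)
    val (◇ φ) = (λ i → ⋀ (λ (f : Filter) → val φ f ⇒ R◇ i f)) ↓

    descr : Fm Atom → Ideal → D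
    descr ⊥' = λ _ → 𝟏
    descr ⊤' = (λ _ → 𝟏) ↑
    descr (var p) = λ i → ifn i (var p)
    descr (φ ∧' ψ) = (λ f → val φ f ∧ val ψ f) ↑
    descr (φ ∨' ψ) = λ i → descr φ i ∧ descr ψ i
    descr (□ φ) = (λ f → ⋀ (λ (i : Ideal) → descr φ i ⇒ R□ f i)) ↑
    descr (◇ φ) = λ i → ⋀ (λ (f : Filter) → val φ f ⇒ R◇ i f)

module Submission where

-- The canonical valuation is defined by ⋀ of residuals over all A-filters
-- (or all A-ideals); one direction of each clause is immediate from the
-- definition of I, R□ and R◇ as joins.  For the other direction it suffices
-- to instantiate the meet at the principal ideal ↓χ (filter ↑χ) generated by
-- the formula χ, whose value at ψ is the truth value ⟦ ψ ⊢ χ ⟧ (resp.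
-- ⟦ χ ⊢ ψ ⟧).  Properness forces ↓χ to vanish on theorems and ↑χ on
-- refutable formulas; this is consistent because both properties are
-- decided by two-valued interpretations of L (this is where the axioms of L
-- are used), and the degenerate cases ⊤' ⊢ χ and χ ⊢ ⊥' are handled
-- directly.

open import Defs
open import Data.Bool using (Bool; true; false; T) renaming (_∨_ to _or_)
open import Data.Bool.Properties using (T-∧; T-∨)
open import Data.Empty using (⊥-elim)
open import Data.Product using (_×_; _,_; proj₁; proj₂)
open import Data.Sum using (inj₁; inj₂; [_,_]′)
open import Data.Unit using (tt)
open import Function.Bundles using (Equivalence)
open import Relation.Nullary using (¬_; yes; no)
open import Relation.Nullary.Decidable using (T?)
open import Relation.Binary.PropositionalEquality using (_≡_; refl; sym; trans; cong; cong₂)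
open import Relation.Binary.Structures using (IsPartialOrder)

open Equivalence using (to; from)

T-extensional : ∀ {a b} → (T a → T b) → (T b → T a) → a ≡ b
T-extensional {false} {false} _ _ = refl
T-extensional {false} {true}  _ h = ⊥-elim (h tt)
T-extensional {true}  {false} h _ = ⊥-elim (h tt)
T-extensional {true}  {true}  _ _ = refl

-- isTheorem χ is the value of χ in the two-element model where atoms and
-- ◇-formulas are false and □ is the identity; isRefutable χ says that χ is
-- false in the two-element model where atoms and □-formulas are true and ◇
-- is the identity.

module Decisions {Atom : Set} where
  open import Data.Bool using (_∧_; _∨_)

  isTheorem : Fm Atom → Bool
  isTheorem ⊥'       = false
  isTheorem ⊤'       = true
  isTheorem (var _)  = false
  isTheorem (φ ∧' ψ) = isTheorem φ ∧ isTheorem ψ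
  isTheorem (φ ∨' ψ) = isTheorem φ ∨ isTheorem ψ
  isTheorem (□ φ)    = isTheorem φ
  isTheorem (◇ _)    = false

  isRefutable : Fm Atom → Bool
  isRefutable ⊥'       = true
  isRefutable ⊤'       = false
  isRefutable (var _)  = false
  isRefutable (φ ∧' ψ) = isRefutable φ ∨ isRefutable ψ
  isRefutable (φ ∨' ψ) = isRefutable φ ∧ isRefutable ψ
  isRefutable (□ _)    = false
  isRefutable (◇ φ)    = isRefutable φ

  isTheorem-sound : ∀ {φ ψ} → φ ⊢ ψ → T (isTheorem φ) → T (isTheorem ψ)
  isTheorem-sound ax           t = t
  isTheorem-sound ⊥-ax         ()
  isTheorem-sound ⊤-ax         _ = tt
  isTheorem-sound ∨-in₁        t = from T-∨ (inj₁ t)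
  isTheorem-sound ∨-in₂        t = from T-∨ (inj₂ t)
  isTheorem-sound ∧-out₁       t = proj₁ (to T-∧ t)
  isTheorem-sound ∧-out₂       t = proj₂ (to T-∧ t)
  isTheorem-sound □⊤           t = t
  isTheorem-sound □∧           t = t
  isTheorem-sound ◇⊥           ()
  isTheorem-sound ◇∨           ()
  isTheorem-sound (cut p q)    t = isTheorem-sound q (isTheorem-sound p t)
  isTheorem-sound (∨-el p q)   t = [ isTheorem-sound p , isTheorem-sound q ]′ (to T-∨ t)
  isTheorem-sound (∧-in p q)   t = from T-∧ (isTheorem-sound p t , isTheorem-sound q t)
  isTheorem-sound (□-mono p)   t = isTheorem-sound p t
  isTheorem-sound (◇-mono _)   ()

  isTheorem-complete : ∀ χ → T (isTheorem χ) → ⊤' ⊢ χ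
  isTheorem-complete ⊤'       _ = ax
  isTheorem-complete (φ ∧' ψ) t =
    ∧-in (isTheorem-complete φ (proj₁ (to T-∧ t))) (isTheorem-complete ψ (proj₂ (to T-∧ t)))
  isTheorem-complete (φ ∨' ψ) t =
    [ (λ tφ → cut (isTheorem-complete φ tφ) ∨-in₁)
    , (λ tψ → cut (isTheorem-complete ψ tψ) ∨-in₂) ]′ (to T-∨ t)
  isTheorem-complete (□ φ)    t = cut □⊤ (□-mono (isTheorem-complete φ t))

  isRefutable-sound : ∀ {φ ψ} → φ ⊢ ψ → T (isRefutable ψ) → T (isRefutable φ)
  isRefutable-sound ax         t = t
  isRefutable-sound ⊥-ax       _ = tt
  isRefutable-sound ⊤-ax       ()
  isRefutable-sound ∨-in₁      t = proj₁ (to T-∧ t)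
  isRefutable-sound ∨-in₂      t = proj₂ (to T-∧ t)
  isRefutable-sound ∧-out₁     t = from T-∨ (inj₁ t)
  isRefutable-sound ∧-out₂     t = from T-∨ (inj₂ t)
  isRefutable-sound □⊤         ()
  isRefutable-sound □∧         ()
  isRefutable-sound ◇⊥         t = t
  isRefutable-sound ◇∨         t = t
  isRefutable-sound (cut p q)  t = isRefutable-sound p (isRefutable-sound q t)
  isRefutable-sound (∨-el p q) t = from T-∧ (isRefutable-sound p t , isRefutable-sound q t)
  isRefutable-sound (∧-in p q) t = [ isRefutable-sound p , isRefutable-sound q ]′ (to T-∨ t)
  isRefutable-sound (□-mono _) ()
  isRefutable-sound (◇-mono p) t = isRefutable-sound p t

  isRefutable-complete : ∀ χ → T (isRefutable χ) → χ ⊢ ⊥'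
  isRefutable-complete ⊥'       _ = ax
  isRefutable-complete (φ ∧' ψ) t =
    [ (λ tφ → cut ∧-out₁ (isRefutable-complete φ tφ))
    , (λ tψ → cut ∧-out₂ (isRefutable-complete ψ tψ)) ]′ (to T-∨ t)
  isRefutable-complete (φ ∨' ψ) t =
    ∨-el (isRefutable-complete φ (proj₁ (to T-∧ t))) (isRefutable-complete ψ (proj₂ (to T-∧ t)))
  isRefutable-complete (◇ φ)    t = cut (◇-mono (isRefutable-complete φ t)) ◇⊥

  isTheorem-resp : ∀ {φ ψ} → φ ⊣⊢ ψ → isTheorem φ ≡ isTheorem ψ
  isTheorem-resp (p , q) = T-extensional (isTheorem-sound p) (isTheorem-sound q)

  isRefutable-resp : ∀ {φ ψ} → φ ⊣⊢ ψ → isRefutable φ ≡ isRefutable ψ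
  isRefutable-resp (p , q) = T-extensional (isRefutable-sound q) (isRefutable-sound p)

module LatticeFacts (A : CARLattice) where
  open CARLattice A
  open IsPartialOrder isPartialOrder using (antisym; reflexive) renaming (trans to ≤-trans; refl to ≤-refl)

  ⊗-monoˡ : ∀ {a b c} → a ≤ b → a ⊗ c ≤ b ⊗ c
  ⊗-monoˡ a≤b = residuation₂ (≤-trans a≤b (residuation₁ ≤-refl))

  ⊗-monoʳ : ∀ {a b c} → b ≤ c → a ⊗ b ≤ a ⊗ c
  ⊗-monoʳ {a} {b} {c} b≤c =
    ≤-trans (reflexive (⊗-comm a b)) (≤-trans (⊗-monoˡ b≤c) (reflexive (⊗-comm c a)))

  -- ⊗ is not assumed unital, but 𝟏 ⇒ x = x makes 𝟏 a subunit.
  ⊗-𝟏-subunit : ∀ x → 𝟏 ⊗ x ≤ x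
  ⊗-𝟏-subunit x =
    ≤-trans (reflexive (⊗-comm 𝟏 x)) (residuation₂ (reflexive (sym (𝟏⇒ x))))

  ⇒-elim-𝟏 : ∀ {y a x} → y ≤ a ⇒ x → 𝟏 ≤ a → y ≤ x
  ⇒-elim-𝟏 {y} {a} {x} y≤a⇒x 𝟏≤a =
    ≤-trans (residuation₁ (≤-trans (⊗-monoʳ 𝟏≤a) (residuation₂ y≤a⇒x))) (reflexive (𝟏⇒ x))

  𝟎-∧ : ∀ x → 𝟎 ∧ x ≡ 𝟎
  𝟎-∧ x = antisym (∧-lb₁ _ _) (𝟎-least _)

  ∧-𝟎 : ∀ x → x ∧ 𝟎 ≡ 𝟎
  ∧-𝟎 x = antisym (∧-lb₂ _ _) (𝟎-least _)

  ⋀-cong : ∀ {J : Set} {g h : J → D} → (∀ j → g j ≡ h j) → ⋀ g ≡ ⋀ h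
  ⋀-cong {g = g} {h} g≡h =
    antisym (⋀-glb h _ (λ j → ≤-trans (⋀-lb g j) (reflexive (g≡h j))))
            (⋀-glb g _ (λ j → ≤-trans (⋀-lb h j) (reflexive (sym (g≡h j)))))

  ⟦_⟧ : Set → D
  ⟦ P ⟧ = ⋁ (λ (_ : P) → 𝟏)

  ⟦⟧-intro : ∀ {P} → P → 𝟏 ≤ ⟦ P ⟧
  ⟦⟧-intro p = ⋁-ub (λ _ → 𝟏) p

  ⟦⟧-map : ∀ {P Q} → (P → Q) → ⟦ P ⟧ ≤ ⟦ Q ⟧
  ⟦⟧-map f = ⋁-lub _ _ (λ p → ⟦⟧-intro (f p))

  ⟦⟧-resp : ∀ {P Q} → (P → Q) → (Q → P) → ⟦ P ⟧ ≡ ⟦ Q ⟧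
  ⟦⟧-resp f g = antisym (⟦⟧-map f) (⟦⟧-map g)

  ⟦⟧-meet : ∀ {P Q R} → (P → Q → R) → ⟦ P ⟧ ∧ ⟦ Q ⟧ ≤ ⟦ R ⟧
  ⟦⟧-meet {P} f =
    ≤-trans (reflexive (frame-distrib ⟦ P ⟧ (λ _ → 𝟏)))
      (⋁-lub _ _ (λ q → ≤-trans (∧-lb₁ _ _) (⟦⟧-map (λ p → f p q))))

  ⟦⟧-conj : ∀ {P Q R} → (R → P) → (R → Q) → (P → Q → R) → ⟦ R ⟧ ≡ ⟦ P ⟧ ∧ ⟦ Q ⟧
  ⟦⟧-conj r→p r→q pq→r = antisym (∧-glb (⟦⟧-map r→p) (⟦⟧-map r→q)) (⟦⟧-meet pq→r)

  ⟦⟧-⊗-lub : ∀ {P x z} → (P → x ≤ z) → ⟦ P ⟧ ⊗ x ≤ z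
  ⟦⟧-⊗-lub {x = x} h =
    residuation₂ (⋁-lub _ _ (λ p → residuation₁ (≤-trans (⊗-𝟏-subunit x) (h p))))

  unless : Bool → D → D
  unless true  _ = 𝟎
  unless false x = x

  unless-≤ : ∀ b x → unless b x ≤ x
  unless-≤ true  x = 𝟎-least x
  unless-≤ false x = ≤-refl

  unless-or : ∀ a b {x y z} → z ≡ x ∧ y → unless (a or b) z ≡ unless a x ∧ unless b y
  unless-or true  _     _   = sym (𝟎-∧ _)
  unless-or false true  _   = sym (∧-𝟎 _)
  unless-or false false z≡ = z≡

module CanonicalModel (Atom : Set) (A : CARLattice) where
  open CARLattice A
  open IsPartialOrder isPartialOrder using (antisym; reflexive) renaming (trans to ≤-trans)
  open Canonical Atom A
  open LatticeFacts A
  open Decisions {Atom}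

  Monotone Antitone : (Fm Atom → D) → Set
  Monotone g = ∀ {ψ χ} → ψ ⊢ χ → g ψ ≤ g χ
  Antitone h = ∀ {ψ χ} → ψ ⊢ χ → h χ ≤ h ψ

  filter-monotone : ∀ f → Monotone (fn f)
  filter-monotone f {ψ} {χ} ψ⊢χ =
    ≤-trans (reflexive (trans (resp f (∧-in ax ψ⊢χ , ∧-out₁)) (f-meet f ψ χ))) (∧-lb₂ _ _)

  ideal-antitone : ∀ i → Antitone (ifn i)
  ideal-antitone i {ψ} {χ} ψ⊢χ =
    ≤-trans (reflexive (trans (iresp i (∨-in₂ , ∨-el ψ⊢χ ax)) (i-join i ψ χ))) (∧-lb₁ _ _)

  principalIdeal : Fm Atom → Ideal
  principalIdeal χ = record
    { ifn    = λ ψ → unless (isTheorem ψ) ⟦ ψ ⊢ χ ⟧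
    ; iresp  = λ { (p , q) → cong₂ unless (isTheorem-resp (p , q)) (⟦⟧-resp (cut q) (cut p)) }
    ; i-bot  = antisym (𝟏-greatest _) (⟦⟧-intro ⊥-ax)
    ; i-top  = refl
    ; i-join = λ φ ψ → unless-or (isTheorem φ) (isTheorem ψ) (⟦⟧-conj (cut ∨-in₁) (cut ∨-in₂) ∨-el)
    }

  principalFilter : Fm Atom → Filter
  principalFilter χ = record
    { fn     = λ ψ → unless (isRefutable ψ) ⟦ χ ⊢ ψ ⟧
    ; resp   = λ { (p , q) → cong₂ unless (isRefutable-resp (p , q)) (⟦⟧-resp (λ r → cut r p) (λ r → cut r q)) }
    ; f-top  = antisym (𝟏-greatest _) (⟦⟧-intro ⊤-ax)
    ; f-bot  = refl
    ; f-meet = λ φ ψ → unless-or (isRefutable φ) (isRefutable ψ)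
                         (⟦⟧-conj (λ r → cut r ∧-out₁) (λ r → cut r ∧-out₂) ∧-in)
    }

  principalIdeal-generator : ∀ χ → ¬ T (isTheorem χ) → 𝟏 ≤ ifn (principalIdeal χ) χ
  principalIdeal-generator χ ¬thm with isTheorem χ
  ... | true  = ⊥-elim (¬thm tt)
  ... | false = ⟦⟧-intro ax

  principalFilter-generator : ∀ χ → ¬ T (isRefutable χ) → 𝟏 ≤ fn (principalFilter χ) χ
  principalFilter-generator χ ¬ref with isRefutable χ
  ... | true  = ⊥-elim (¬ref tt)
  ... | false = ⟦⟧-intro ax

  ideal-representation : (g : Fm Atom → D) → Monotone g → 𝟏 ≤ g ⊤' →
                         ∀ χ {u : Ideal → D} → (∀ i → u i ≡ ifn i χ) →
                         ⋀ (λ i → u i ⇒ ⋁ (λ ψ → g ψ ⊗ ifn i ψ)) ≡ g χ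
  ideal-representation g mono top χ {u} u≡χ =
    trans (⋀-cong (λ i → cong (_⇒ X i) (u≡χ i))) (antisym upper lower)
    where
      X : Ideal → D
      X i = ⋁ (λ ψ → g ψ ⊗ ifn i ψ)

      lower : g χ ≤ ⋀ (λ i → ifn i χ ⇒ X i)
      lower = ⋀-glb _ _ (λ i → residuation₁ (⋁-ub (λ ψ → g ψ ⊗ ifn i ψ) χ))

      -- In ↓χ only formulas below χ contribute.
      X-principal : X (principalIdeal χ) ≤ g χ
      X-principal = ⋁-lub _ _ (λ ψ →
        ≤-trans (reflexive (⊗-comm (g ψ) _))
          (≤-trans (⊗-monoˡ (unless-≤ (isTheorem ψ) _)) (⟦⟧-⊗-lub mono)))

      upper : ⋀ (λ i → ifn i χ ⇒ X i) ≤ g χ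
      upper with T? (isTheorem χ)
      ... | yes thm = ≤-trans (𝟏-greatest _) (≤-trans top (mono (isTheorem-complete χ thm)))
      ... | no ¬thm = ≤-trans
        (⇒-elim-𝟏 (⋀-lb (λ i → ifn i χ ⇒ X i) (principalIdeal χ)) (principalIdeal-generator χ ¬thm))
        X-principal

  filter-representation : (h : Fm Atom → D) → Antitone h → 𝟏 ≤ h ⊥' →
                          ∀ χ {v : Filter → D} → (∀ f → v f ≡ fn f χ) →
                          ⋀ (λ f → v f ⇒ ⋁ (λ ψ → fn f ψ ⊗ h ψ)) ≡ h χ
  filter-representation h anti bot χ {v} v≡χ =
    trans (⋀-cong (λ f → cong (_⇒ Y f) (v≡χ f))) (antisym upper lower)
    where
      Y : Filter → D
      Y f = ⋁ (λ ψ → fn f ψ ⊗ h ψ)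

      lower : h χ ≤ ⋀ (λ f → fn f χ ⇒ Y f)
      lower = ⋀-glb _ _ (λ f → residuation₁
        (≤-trans (reflexive (⊗-comm (h χ) _)) (⋁-ub (λ ψ → fn f ψ ⊗ h ψ) χ)))

      -- In ↑χ only formulas above χ contribute.
      Y-principal : Y (principalFilter χ) ≤ h χ
      Y-principal = ⋁-lub _ _ (λ ψ →
        ≤-trans (⊗-monoˡ (unless-≤ (isRefutable ψ) _)) (⟦⟧-⊗-lub anti))

      upper : ⋀ (λ f → fn f χ ⇒ Y f) ≤ h χ
      upper with T? (isRefutable χ)
      ... | yes ref = ≤-trans (𝟏-greatest _) (≤-trans bot (anti (isRefutable-complete χ ref)))
      ... | no ¬ref = ≤-trans
        (⇒-elim-𝟏 (⋀-lb (λ f → fn f χ ⇒ Y f) (principalFilter χ)) (principalFilter-generator χ ¬ref))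
        Y-principal

  ↓-representation : ∀ χ {u : Ideal → D} → (∀ i → u i ≡ ifn i χ) → ∀ f → (u ↓) f ≡ fn f χ
  ↓-representation χ u≡χ f =
    ideal-representation (fn f) (filter-monotone f) (reflexive (sym (f-top f))) χ u≡χ

  ↑-representation : ∀ χ {v : Filter → D} → (∀ f → v f ≡ fn f χ) → ∀ i → (v ↑) i ≡ ifn i χ
  ↑-representation χ v≡χ i =
    filter-representation (ifn i) (ideal-antitone i) (reflexive (sym (i-bot i))) χ v≡χ

  □-representation : ∀ χ {u : Ideal → D} → (∀ i → u i ≡ ifn i χ) →
                     ∀ f → ⋀ (λ i → u i ⇒ R□ f i) ≡ fn f (□ χ)
  □-representation χ u≡χ f =
    ideal-representation (λ ψ → fn f (□ ψ)) (λ p → filter-monotone f (□-mono p))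
      (≤-trans (reflexive (sym (f-top f))) (filter-monotone f □⊤)) χ u≡χ

  ◇-representation : ∀ χ {v : Filter → D} → (∀ f → v f ≡ fn f χ) →
                     ∀ i → ⋀ (λ f → v f ⇒ R◇ i f) ≡ ifn i (◇ χ)
  ◇-representation χ v≡χ i =
    filter-representation (λ ψ → ifn i (◇ ψ)) (λ p → ideal-antitone i (◇-mono p))
      (≤-trans (reflexive (sym (i-bot i))) (ideal-antitone i ◇⊥)) χ v≡χ

  ValTruth DescrTruth : Fm Atom → Set
  ValTruth φ   = ∀ f → val φ f ≡ fn f φ
  DescrTruth φ = ∀ i → descr φ i ≡ ifn i φ

  truth : ∀ φ → ValTruth φ × DescrTruth φ
  truth ⊥'       = ↓-representation ⊥' bot , bot
    where
      bot : DescrTruth ⊥'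
      bot i = sym (i-bot i)
  truth ⊤'       = top , ↑-representation ⊤' top
    where
      top : ValTruth ⊤'
      top f = sym (f-top f)
  truth (var p)  = (λ _ → refl) , (λ _ → refl)
  truth (φ ∧' ψ) = meet , ↑-representation (φ ∧' ψ) meet
    where
      meet : ValTruth (φ ∧' ψ)
      meet f = trans (cong₂ _∧_ (proj₁ (truth φ) f) (proj₁ (truth ψ) f)) (sym (f-meet f φ ψ))
  truth (φ ∨' ψ) = ↓-representation (φ ∨' ψ) join , join
    where
      join : DescrTruth (φ ∨' ψ)
      join i = trans (cong₂ _∧_ (proj₂ (truth φ) i) (proj₂ (truth ψ) i)) (sym (i-join i φ ψ))
  truth (□ φ)    = box , ↑-representation (□ φ) box
    where
      box : ValTruth (□ φ)
      box = □-representation φ (proj₂ (truth φ))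
  truth (◇ φ)    = ↓-representation (◇ φ) diamond , diamond
    where
      diamond : DescrTruth (◇ φ)
      diamond = ◇-representation φ (proj₁ (truth φ))

lemmaA7 : (Atom : Set) (A : CARLattice) (φ : Fm Atom) →
            ((f : Canonical.Filter Atom A) → Canonical.val Atom A φ f ≡ Canonical.Filter.fn f φ)
            × ((i : Canonical.Ideal Atom A) → Canonical.descr Atom A φ i ≡ Canonical.Ideal.ifn i φ)
lemmaA7 Atom A = CanonicalModel.truth Atom A
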